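{- Let $Q$ be a $\star$-autonomous quantale and $d\ge2$. Suppose that for each $f\in Q^{\langle d\rangle}$ one has $\overline{\mathring{(\overline{f})}}=\mathring{(\overline{f})}$. Then for each $f\in Q^{\langle d\rangle}$ one also has $\mathring{(\overline{\mathring{f}})}=\overline{\mathring{f}}$, and the set of clopen tuples of $Q^{\langle d\rangle}$, ordered pointwise, is a lattice.
   Context: A $\star$-autonomous quantale is a tuple $\langle Q,1,\otimes,0,\oplus,(-)^\star\rangle$ where $Q$ is a complete lattice, $(1,\otimes)$ is a monoid structure with $\otimes$ distributing over arbitrary joins in each variable, $(-)^\star$ is an order-reversing involution of $Q$, $0=1^\star$, $f\oplus g=(g^\star\otimes f^\star)^\star$, and $f\otimes g\le h$ iff $f\le h\oplus g^\star$ iff $g\le f^\star\oplus h$. Let $\langle d\rangle=\{(i,j)\mid1\le i<j\le d\}$ and $Q^{\langle d\rangle}=\prod_{(i,j)\in\langle d\rangle}Q$, pointwise ordered. A tuple $f$ is closed if $f_{i,j}\otimes f_{j,k}\le f_{i,k}$ for all $i<j<k$, open if $f_{i,k}\le f_{i,j}\oplus f_{j,k}$ for all $i<j<k$, clopen if both. The closure $\overline{f}$ is the least closed tuple above $f$, given by $\overline{f}_{i,j}=\bigvee f_{i,\ell_1}\otimes f_{\ell_1,\ell_2}\otimes\cdots\otimes f_{\ell_{k-1},j}$, and the interior $\mathring{f}$ is the greatest open tuple below $f$, given by $\mathring{f}_{i,j}=\bigwedge f_{i,\ell_1}\oplus\cdots\oplus f_{\ell_{k-1},j}$, both ranging over all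 sequences $i=\ell_0<\ell_1<\dots<\ell_k=j$ in $\{1,\dots,d\}$ with $k\ge1$. -}

module Defs where

open import Level using (Level; Lift; lift; lower) renaming (suc to lsuc)
open import Data.Nat using (ℕ)
open import Data.Fin using (Fin; _<_)
open import Data.Fin.Properties using (<-trans)
open import Data.Product using (Σ; _×_; _,_)
open import Relation.Binary.PropositionalEquality using (_≡_)
open import Relation.Binary.Structures using (IsPartialOrder)
open import Function.Bundles using (_⇔_)

record StarAutQuantale (c : Level) : Set (lsuc c) where
  infixl 7 _⊗_
  infix 4 _≤_
  field
    Carrier : Set c
    _≤_ : Carrier → Carrier → Set c
    isPartialOrder : IsPartialOrder _≡_ _≤_
    ⋁ : {I : Set c} → (I → Carrier) → Carrier
    ⋁-upper : {I : Set c} (f : I → Carrier) (i : I) → f i ≤ ⋁ f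
    ⋁-least : {I : Set c} (f : I → Carrier) (x : Carrier) →
              (∀ i → f i ≤ x) → ⋁ f ≤ x
    ⋀ : {I : Set c} → (I → Carrier) → Carrier
    ⋀-lower : {I : Set c} (f : I → Carrier) (i : I) → ⋀ f ≤ f i
    ⋀-greatest : {I : Set c} (f : I → Carrier) (x : Carrier) →
                 (∀ i → x ≤ f i) → x ≤ ⋀ f
    1# : Carrier
    _⊗_ : Carrier → Carrier → Carrier
    ⊗-assoc : ∀ x y z → (x ⊗ y) ⊗ z ≡ x ⊗ (y ⊗ z)
    ⊗-identityˡ : ∀ x → 1# ⊗ x ≡ x
    ⊗-identityʳ : ∀ x → x ⊗ 1# ≡ x
    ⊗-distribˡ-⋁ : {I : Set c} (x : Carrier) (f : I → Carrier) →
                   x ⊗ ⋁ f ≡ ⋁ (λ i → x ⊗ f i)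
    ⊗-distribʳ-⋁ : {I : Set c} (f : I → Carrier) (x : Carrier) →
                   ⋁ f ⊗ x ≡ ⋁ (λ i → f i ⊗ x)
    _⋆ : Carrier → Carrier
    ⋆-involutive : ∀ x → (x ⋆) ⋆ ≡ x
    ⋆-antitone : ∀ {x y} → x ≤ y → y ⋆ ≤ x ⋆

  infixl 6 _⊕_
  0# : Carrier
  0# = 1# ⋆

  _⊕_ : Carrier → Carrier → Carrier
  f ⊕ g = ((g ⋆) ⊗ (f ⋆)) ⋆

  field
    residuationˡ : ∀ f g h → (f ⊗ g ≤ h) ⇔ (f ≤ h ⊕ (g ⋆))
    residuationʳ : ∀ f g h → (f ⊗ g ≤ h) ⇔ (g ≤ (f ⋆) ⊕ h)

module Tuples {c : Level} (Q : StarAutQuantale c) (d : ℕ) where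
  open StarAutQuantale Q

  -- an element of Q^⟨d⟩: an entry f i j for each pair i < j in {1,…,d}
  -- (here Fin d = {0,…,d-1})
  Tuple : Set c
  Tuple = (i j : Fin d) → i < j → Carrier

  _≤ᵗ_ : Tuple → Tuple → Set c
  f ≤ᵗ g = ∀ i j (p : i < j) → f i j p ≤ g i j p

  _≐_ : Tuple → Tuple → Set c
  f ≐ g = ∀ i j (p : i < j) → f i j p ≡ g i j p

  IsClosed : Tuple → Set c
  IsClosed f = ∀ i j k (p : i < j) (q : j < k) →
               f i j p ⊗ f j k q ≤ f i k (<-trans p q)

  IsOpen : Tuple → Set c
  IsOpen f = ∀ i j k (p : i < j) (q : j < k) →
             f i k (<-trans p q) ≤ f i j p ⊕ f j k q

  IsClopen : Tuple → Set c
  IsClopen f = IsClosed f × IsOpen f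

  -- strictly increasing sequences i = ℓ₀ < ℓ₁ < … < ℓₖ = j, k ≥ 1
  data Chain : Fin d → Fin d → Set where
    last : ∀ {i j} → i < j → Chain i j
    _∷_  : ∀ {i l j} → i < l → Chain l j → Chain i j

  prodᶜ : Tuple → ∀ {i j} → Chain i j → Carrier
  prodᶜ f {i} {j} (last p) = f i j p
  prodᶜ f {i} (_∷_ {l = l} p ch) = f i l p ⊗ prodᶜ f ch

  sumᶜ : Tuple → ∀ {i j} → Chain i j → Carrier
  sumᶜ f {i} {j} (last p) = f i j p
  sumᶜ f {i} (_∷_ {l = l} p ch) = f i l p ⊕ sumᶜ f ch

  closure : Tuple → Tuple
  closure f i j _ = ⋁ {I = Lift c (Chain i j)} (λ ch → prodᶜ f (lower ch))

  interior : Tuple → Tuple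
  interior f i j _ = ⋀ {I = Lift c (Chain i j)} (λ ch → sumᶜ f (lower ch))

  ClopenJoin : Tuple → Tuple → Tuple → Set c
  ClopenJoin f g h = IsClopen h × f ≤ᵗ h × g ≤ᵗ h ×
    (∀ k → IsClopen k → f ≤ᵗ k → g ≤ᵗ k → h ≤ᵗ k)

  ClopenMeet : Tuple → Tuple → Tuple → Set c
  ClopenMeet f g h = IsClopen h × h ≤ᵗ f × h ≤ᵗ g ×
    (∀ k → IsClopen k → k ≤ᵗ f → k ≤ᵗ g → k ≤ᵗ h)

  ClopensFormLattice : Set c
  ClopensFormLattice = ∀ f g → IsClopen f → IsClopen g →
    Σ Tuple (ClopenJoin f g) × Σ Tuple (ClopenMeet f g)

module Submission where

-- Closure and interior on Q^⟨d⟩ are a closure operator and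
-- an interior operator: the closure of f is closed, lies above f and below
-- every closed tuple above f; dually for the interior.  The hypothesis says
-- that the interior of every closed tuple is again closed.  Hence
--   * for any f, the interior of cl(int f) is a closed tuple above int f
--     (int f is open and below cl(int f)), so it lies above cl(int f);
--     being also below it, the two agree: cl(int f) is open;
--   * for clopen f, g the clopen join is int(cl(f ∨ g)) and the clopen meet
--     is cl(int(f ∧ g)), where ∨, ∧ are the pointwise binary join and meet.

open import Defs
open import Level using (Level; Lift; lift; lower)
open import Data.Nat using (ℕ)
open import Data.Bool using (Bool; true; false)
open import Data.Product using (_×_; _,_; proj₁)
open import Data.Fin using () renaming (_<_ to _<ᶠ_)
open import Data.Fin.Properties using (<-trans; <-irrelevant)
open import Relation.Binary.PropositionalEquality
  using (_≡_; refl; sym; trans; cong; cong₂; subst; subst₂)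
open import Relation.Binary.Structures using (IsPartialOrder)
open import Function.Bundles using (Equivalence)

module QuantaleFacts {c : Level} (Q : StarAutQuantale c) where
  open StarAutQuantale Q
  open IsPartialOrder isPartialOrder using (antisym)
    renaming (refl to ≤-refl; trans to ≤-trans) public
  open Equivalence

  ⊕-residualʳ⁻ : ∀ {x a b} → x ≤ a ⊕ b → x ⊗ b ⋆ ≤ a
  ⊕-residualʳ⁻ {x} {a} {b} p = from (residuationˡ x (b ⋆) a)
    (subst (λ t → x ≤ a ⊕ t) (sym (⋆-involutive b)) p)

  ⊕-residualʳ⁺ : ∀ {x a b} → x ⊗ b ⋆ ≤ a → x ≤ a ⊕ b
  ⊕-residualʳ⁺ {x} {a} {b} p =
    subst (λ t → x ≤ a ⊕ t) (⋆-involutive b) (to (residuationˡ x (b ⋆) a) p)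

  ⊕-residualˡ⁻ : ∀ {x a b} → x ≤ a ⊕ b → a ⋆ ⊗ x ≤ b
  ⊕-residualˡ⁻ {x} {a} {b} p = from (residuationʳ (a ⋆) x b)
    (subst (λ t → x ≤ t ⊕ b) (sym (⋆-involutive a)) p)

  ⊕-residualˡ⁺ : ∀ {x a b} → a ⋆ ⊗ x ≤ b → x ≤ a ⊕ b
  ⊕-residualˡ⁺ {x} {a} {b} p =
    subst (λ t → x ≤ t ⊕ b) (⋆-involutive a) (to (residuationʳ (a ⋆) x b) p)

  -- ⊗ is monotone in each argument, since it has right adjoints.
  ⊗-monoˡ : ∀ {x y} z → x ≤ y → x ⊗ z ≤ y ⊗ z
  ⊗-monoˡ {x} {y} z x≤y = from (residuationˡ x z (y ⊗ z))
    (≤-trans x≤y (to (residuationˡ y z (y ⊗ z)) ≤-refl))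

  ⊗-monoʳ : ∀ {x y} z → x ≤ y → z ⊗ x ≤ z ⊗ y
  ⊗-monoʳ {x} {y} z x≤y = from (residuationʳ z x (z ⊗ y))
    (≤-trans x≤y (to (residuationʳ z y (z ⊗ y)) ≤-refl))

  ⊗-mono : ∀ {a b x y} → a ≤ b → x ≤ y → a ⊗ x ≤ b ⊗ y
  ⊗-mono {x = x} a≤b x≤y = ≤-trans (⊗-monoˡ x a≤b) (⊗-monoʳ _ x≤y)

  -- ⊕ is monotone, being ⊗ conjugated by the antitone involution.
  ⊕-mono : ∀ {a b x y} → a ≤ b → x ≤ y → a ⊕ x ≤ b ⊕ y
  ⊕-mono a≤b x≤y = ⋆-antitone (⊗-mono (⋆-antitone x≤y) (⋆-antitone a≤b))

  -- ⊕ inherits associativity from ⊗.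
  ⊕-assoc : ∀ x y z → (x ⊕ y) ⊕ z ≡ x ⊕ (y ⊕ z)
  ⊕-assoc x y z = cong _⋆ (trans (cong (z ⋆ ⊗_) (⋆-involutive _))
    (trans (sym (⊗-assoc _ _ _)) (cong (_⊗ x ⋆) (sym (⋆-involutive _)))))

  -- A product of two joins lies below h as soon as all products of
  -- their members do (⊗ preserves joins in each variable).
  ⊗-⋁-least : ∀ {I J : Set c} (f : I → Carrier) (g : J → Carrier) h →
              (∀ a b → f a ⊗ g b ≤ h) → ⋁ f ⊗ ⋁ g ≤ h
  ⊗-⋁-least f g h fg≤h = from (residuationˡ _ _ _) (⋁-least _ _ λ a →
    to (residuationˡ _ _ _) (from (residuationʳ _ _ _) (⋁-least _ _ λ b →
      to (residuationʳ _ _ _) (fg≤h a b))))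

  ⊕-⋀-greatest : ∀ {I J : Set c} (f : I → Carrier) (g : J → Carrier) h →
                 (∀ a b → h ≤ f a ⊕ g b) → h ≤ ⋀ f ⊕ ⋀ g
  ⊕-⋀-greatest f g h h≤fg = ⊕-residualʳ⁺ (⋀-greatest _ _ λ a →
    ⊕-residualʳ⁻ (⊕-residualˡ⁺ (⋀-greatest _ _ λ b →
      ⊕-residualˡ⁻ (h≤fg a b))))

module TupleOperators {c : Level} (Q : StarAutQuantale c) (d : ℕ) where
  open StarAutQuantale Q
  open QuantaleFacts Q
  open Tuples Q d

  entry-irrelevant : ∀ (f : Tuple) {i j} (p q : i <ᶠ j) → f i j p ≡ f i j q
  entry-irrelevant f p q = cong (f _ _) (<-irrelevant p q)

  chain-< : ∀ {i j} → Chain i j → i <ᶠ j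
  chain-< (last p) = p
  chain-< (p ∷ ch) = <-trans p (chain-< ch)

  _++_ : ∀ {i j k} → Chain i j → Chain j k → Chain i k
  last p ++ ch′ = p ∷ ch′
  (p ∷ ch) ++ ch′ = p ∷ (ch ++ ch′)

  prod-++ : ∀ f {i j k} (ch : Chain i j) (ch′ : Chain j k) →
            prodᶜ f (ch ++ ch′) ≡ prodᶜ f ch ⊗ prodᶜ f ch′
  prod-++ f (last p) ch′ = refl
  prod-++ f (p ∷ ch) ch′ =
    trans (cong (f _ _ p ⊗_) (prod-++ f ch ch′)) (sym (⊗-assoc _ _ _))

  sum-++ : ∀ f {i j k} (ch : Chain i j) (ch′ : Chain j k) →
           sumᶜ f (ch ++ ch′) ≡ sumᶜ f ch ⊕ sumᶜ f ch′
  sum-++ f (last p) ch′ = refl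
  sum-++ f (p ∷ ch) ch′ =
    trans (cong (f _ _ p ⊕_) (sum-++ f ch ch′)) (sym (⊕-assoc _ _ _))

  sum-mono : ∀ {f g} → f ≤ᵗ g → ∀ {i j} (ch : Chain i j) → sumᶜ f ch ≤ sumᶜ g ch
  sum-mono f≤g (last p) = f≤g _ _ p
  sum-mono f≤g (p ∷ ch) = ⊕-mono (f≤g _ _ p) (sum-mono f≤g ch)

  prod-below-closed : ∀ {g k} → IsClosed k → g ≤ᵗ k →
                      ∀ {i j} (ch : Chain i j) (p : i <ᶠ j) → prodᶜ g ch ≤ k i j p
  prod-below-closed {g} {k} k-closed g≤k (last p′) p =
    subst (g _ _ p′ ≤_) (entry-irrelevant k p′ p) (g≤k _ _ p′)
  prod-below-closed {k = k} k-closed g≤k (p′ ∷ ch) p =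
    subst (_ ≤_) (entry-irrelevant k _ p)
      (≤-trans (⊗-mono (g≤k _ _ p′) (prod-below-closed k-closed g≤k ch (chain-< ch)))
               (k-closed _ _ _ p′ (chain-< ch)))

  sum-above-open : ∀ {g} → IsOpen g →
                   ∀ {i j} (ch : Chain i j) (p : i <ᶠ j) → g i j p ≤ sumᶜ g ch
  sum-above-open {g} g-open (last p′) p =
    subst (_≤ g _ _ p′) (entry-irrelevant g p′ p) ≤-refl
  sum-above-open {g} g-open (p′ ∷ ch) p =
    subst (_≤ sumᶜ g (p′ ∷ ch)) (entry-irrelevant g _ p)
      (≤-trans (g-open _ _ _ p′ (chain-< ch))
               (⊕-mono ≤-refl (sum-above-open g-open ch (chain-< ch))))

  closure-closed : ∀ f → IsClosed (closure f)
  closure-closed f i j k p q = ⊗-⋁-least _ _ _ λ ch ch′ →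
    subst (_≤ closure f i k (<-trans p q)) (prod-++ f (lower ch) (lower ch′))
      (⋁-upper _ (lift (lower ch ++ lower ch′)))

  closure-extensive : ∀ f → f ≤ᵗ closure f
  closure-extensive f i j p = ⋁-upper _ (lift (last p))

  closure-least : ∀ {g k} → IsClosed k → g ≤ᵗ k → closure g ≤ᵗ k
  closure-least k-closed g≤k i j p =
    ⋁-least _ _ λ ch → prod-below-closed k-closed g≤k (lower ch) p

  interior-open : ∀ f → IsOpen (interior f)
  interior-open f i j k p q = ⊕-⋀-greatest _ _ _ λ ch ch′ →
    subst (interior f i k (<-trans p q) ≤_) (sum-++ f (lower ch) (lower ch′))
      (⋀-lower _ (lift (lower ch ++ lower ch′)))

  interior-deflationary : ∀ f → interior f ≤ᵗ f
  interior-deflationary f i j p = ⋀-lower _ (lift (last p))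

  interior-greatest : ∀ {g k} → IsOpen g → g ≤ᵗ k → g ≤ᵗ interior k
  interior-greatest g-open g≤k i j p = ⋀-greatest _ _ λ ch →
    ≤-trans (sum-above-open g-open (lower ch) p) (sum-mono g≤k (lower ch))

  closed-resp-≐ : ∀ {f g} → f ≐ g → IsClosed f → IsClosed g
  closed-resp-≐ f≐g f-closed i j k p q =
    subst₂ _≤_ (cong₂ _⊗_ (f≐g i j p) (f≐g j k q)) (f≐g i k _) (f-closed i j k p q)

  open-resp-≐ : ∀ {f g} → f ≐ g → IsOpen f → IsOpen g
  open-resp-≐ f≐g f-open i j k p q =
    subst₂ _≤_ (f≐g i k _) (cong₂ _⊕_ (f≐g i j p) (f≐g j k q)) (f-open i j k p q)

  pair : ∀ {A : Set c} → A → A → Lift c Bool → A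
  pair x y (lift true)  = x
  pair x y (lift false) = y

  infixl 30 _∨ᵗ_
  infixl 35 _∧ᵗ_
  _∨ᵗ_ _∧ᵗ_ : Tuple → Tuple → Tuple
  (f ∨ᵗ g) i j p = ⋁ (pair (f i j p) (g i j p))
  (f ∧ᵗ g) i j p = ⋀ (pair (f i j p) (g i j p))

  ∨ᵗ-upperˡ : ∀ f g → f ≤ᵗ f ∨ᵗ g
  ∨ᵗ-upperˡ f g i j p = ⋁-upper _ (lift true)

  ∨ᵗ-upperʳ : ∀ f g → g ≤ᵗ f ∨ᵗ g
  ∨ᵗ-upperʳ f g i j p = ⋁-upper _ (lift false)

  ∨ᵗ-least : ∀ {f g k} → f ≤ᵗ k → g ≤ᵗ k → f ∨ᵗ g ≤ᵗ k
  ∨ᵗ-least f≤k g≤k i j p =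
    ⋁-least _ _ λ { (lift true) → f≤k i j p ; (lift false) → g≤k i j p }

  ∧ᵗ-lowerˡ : ∀ f g → f ∧ᵗ g ≤ᵗ f
  ∧ᵗ-lowerˡ f g i j p = ⋀-lower _ (lift true)

  ∧ᵗ-lowerʳ : ∀ f g → f ∧ᵗ g ≤ᵗ g
  ∧ᵗ-lowerʳ f g i j p = ⋀-lower _ (lift false)

  ∧ᵗ-greatest : ∀ {f g k} → k ≤ᵗ f → k ≤ᵗ g → k ≤ᵗ f ∧ᵗ g
  ∧ᵗ-greatest k≤f k≤g i j p =
    ⋀-greatest _ _ λ { (lift true) → k≤f i j p ; (lift false) → k≤g i j p }

  ∧ᵗ-closed : ∀ {f g} → IsClosed f → IsClosed g → IsClosed (f ∧ᵗ g)
  ∧ᵗ-closed {f} {g} f-closed g-closed i j k p q = ⋀-greatest _ _ λ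
    { (lift true)  → ≤-trans (⊗-mono (∧ᵗ-lowerˡ f g i j p) (∧ᵗ-lowerˡ f g j k q))
                             (f-closed i j k p q)
    ; (lift false) → ≤-trans (⊗-mono (∧ᵗ-lowerʳ f g i j p) (∧ᵗ-lowerʳ f g j k q))
                             (g-closed i j k p q) }

  module _ (int-cl-closed : ∀ f → closure (interior (closure f)) ≐ interior (closure f)) where

    interior-of-closure-clopen : ∀ f → IsClopen (interior (closure f))
    interior-of-closure-clopen f =
      closed-resp-≐ (int-cl-closed f) (closure-closed _) , interior-open _

    -- cl(int f) is below the closed tuple int(cl(int f)), which lies above
    -- the open tuple int f; so the interior of cl(int f) is cl(int f).
    closure-of-interior-open : ∀ f → interior (closure (interior f)) ≐ closure (interior f)
    closure-of-interior-open f i j p = antisym (interior-deflationary _ i j p)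
      (closure-least (proj₁ (interior-of-closure-clopen (interior f)))
        (interior-greatest (interior-open f) (closure-extensive (interior f))) i j p)

    clopen-join : ∀ f g → IsClopen f → IsClopen g →
                  ClopenJoin f g (interior (closure (f ∨ᵗ g)))
    clopen-join f g (_ , f-open) (_ , g-open) =
        interior-of-closure-clopen (f ∨ᵗ g)
      , interior-greatest f-open (λ i j p →
          ≤-trans (∨ᵗ-upperˡ f g i j p) (closure-extensive _ i j p))
      , interior-greatest g-open (λ i j p →
          ≤-trans (∨ᵗ-upperʳ f g i j p) (closure-extensive _ i j p))
      , λ k (k-closed , _) f≤k g≤k i j p →
          ≤-trans (interior-deflationary _ i j p)
                  (closure-least k-closed (∨ᵗ-least f≤k g≤k) i j p)

    clopen-meet : ∀ f g → IsClopen f → IsClopen g →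
                  ClopenMeet f g (closure (interior (f ∧ᵗ g)))
    clopen-meet f g (f-closed , _) (g-closed , _) =
        (closure-closed _ , open-resp-≐ (closure-of-interior-open (f ∧ᵗ g)) (interior-open _))
      , (λ i j p → ≤-trans (below-meet i j p) (∧ᵗ-lowerˡ f g i j p))
      , (λ i j p → ≤-trans (below-meet i j p) (∧ᵗ-lowerʳ f g i j p))
      , λ k (_ , k-open) k≤f k≤g i j p →
          ≤-trans (interior-greatest k-open (∧ᵗ-greatest k≤f k≤g) i j p)
                  (closure-extensive _ i j p)
      where
      below-meet : closure (interior (f ∧ᵗ g)) ≤ᵗ f ∧ᵗ g
      below-meet = closure-least (∧ᵗ-closed f-closed g-closed)
                                 (interior-deflationary (f ∧ᵗ g))

-- The order on ℕ is opened only here, as the quantale order uses the same name.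
open Data.Nat using (_≤_)

proposition1 : {c : Level} (Q : StarAutQuantale c) (d : ℕ) → 2 ≤ d →
    let open Tuples Q d in
    (∀ f → closure (interior (closure f)) ≐ interior (closure f)) →
    (∀ f → interior (closure (interior f)) ≐ closure (interior f))
    × ClopensFormLattice
proposition1 Q d _ int-cl-closed =
    closure-of-interior-open int-cl-closed
  , λ f g f-clopen g-clopen →
      (_ , clopen-join int-cl-closed f g f-clopen g-clopen)
    , (_ , clopen-meet int-cl-closed f g f-clopen g-clopen)
  where open TupleOperators Q d
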